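{- A GM-move $x \to x'$ respects monotonicity: if $x_1 \le \cdots \le x_n$, then $x'_1 \le \cdots \le x'_n$.
   Context: Fix integers $n,k,\ell$ with $0<k<n$ and $1<\ell$, and an integer vector $x=(x_1,\ldots,x_n)$. Let $m(x)$ be the number of entries of $x$ that are multiples of $\ell$. Choose $n-k$ entries (bears): if $n-k\le m(x)$, the $n-k$ smallest entries that are multiples of $\ell$; if $n-k>m(x)$, all $m(x)$ such entries plus $n-k-m(x)$ others (e.g. the largest ones). Ties are broken by always choosing entries with the largest indices (the rightmost ones). A GM-move $x\to x'$ keeps the $n-k$ bearish entries unchanged and reduces each of the remaining $k$ (bullish) entries by $1$. -}

module Defs where

open import Data.Bool using (Bool; true; false; if_then_else_; _∧_; _∨_)
open import Data.Nat as ℕ using (ℕ; zero; suc; _∸_)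
open import Data.Nat.Divisibility using (_∣?_)
open import Data.Integer as ℤ using (ℤ; ∣_∣)
open import Data.Fin as Fin using (Fin)
open import Relation.Nullary.Decidable using (⌊_⌋)

count : ∀ {n} → (Fin n → Bool) → ℕ
count {zero}  p = 0
count {suc n} p = (if p Fin.zero then 1 else 0) ℕ.+ count (λ i → p (Fin.suc i))

isMult : ℕ → ℤ → Bool
isMult ℓ a = ⌊ ℓ ∣? ∣ a ∣ ⌋

-- beats ℓ x j i = true  iff index j is preferred over index i when choosing bears:
--  * multiples of ℓ are preferred over non-multiples;
--  * among multiples: smaller value first;
--  * among non-multiples: larger value first;
--  * ties (equal values) broken in favour of the larger (rightmost) index.
beats : ∀ {n} → ℕ → (Fin n → ℤ) → Fin n → Fin n → Bool
beats ℓ x j i with isMult ℓ (x j) | isMult ℓ (x i)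
... | true  | false = true
... | false | true  = false
... | true  | true  = ⌊ x j ℤ.<? x i ⌋ ∨ (⌊ x j ℤ.≟ x i ⌋ ∧ ⌊ i Fin.<? j ⌋)
... | false | false = ⌊ x i ℤ.<? x j ⌋ ∨ (⌊ x j ℤ.≟ x i ⌋ ∧ ⌊ i Fin.<? j ⌋)

rank : ∀ {n} → ℕ → (Fin n → ℤ) → Fin n → ℕ
rank ℓ x i = count (λ j → beats ℓ x j i)

isBear : ∀ {n} → ℕ → ℕ → (Fin n → ℤ) → Fin n → Bool
isBear {n} k ℓ x i = ⌊ rank ℓ x i ℕ.<? (n ∸ k) ⌋

gmMove : ∀ {n} → ℕ → ℕ → (Fin n → ℤ) → (Fin n → ℤ)
gmMove k ℓ x i = if isBear k ℓ x i then x i else x i ℤ.- ℤ.1ℤ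

Monotone : ∀ {n} → (Fin n → ℤ) → Set
Monotone x = ∀ i j → i Fin.≤ j → x i ℤ.≤ x j

-- Among equal entries the tie-break prefers the rightmost index, so every index
-- beating xⱼ also beats an equal entry xᵢ with i ≤ j; hence xᵢ has rank at least
-- that of xⱼ, and if i is a bear so is j.  A bear left of a bull is therefore
-- strictly smaller and stays ≤ after the bull drops by 1; in every other case
-- both sides move together or only the left one drops.
module Submission where

open import Defs
open import Data.Bool using (Bool; true; false; T; _∧_; _∨_)
open import Data.Nat as ℕ using (ℕ; zero; suc; _<_)
import Data.Nat.Properties as ℕ
open import Data.Integer as ℤ using (ℤ; 1ℤ; -1ℤ; _-_)
import Data.Integer.Properties as ℤ
open import Data.Fin as Fin using (Fin)
open import Relation.Binary.PropositionalEquality using (_≡_; cong; subst)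
open import Relation.Nullary.Decidable using (⌊_⌋; toWitness; fromWitness)

count-mono : ∀ {n} {p q : Fin n → Bool} → (∀ i → T (p i) → T (q i)) →
  count p ℕ.≤ count q
count-mono {zero}          _   = ℕ.z≤n
count-mono {suc n} {p} {q} p⇒q with p Fin.zero | q Fin.zero | p⇒q Fin.zero
... | true  | true  | _    = ℕ.s≤s (count-mono (λ i → p⇒q (Fin.suc i)))
... | false | true  | _    = ℕ.m≤n⇒m≤1+n (count-mono (λ i → p⇒q (Fin.suc i)))
... | false | false | _    = count-mono (λ i → p⇒q (Fin.suc i))
... | true  | false | p⇒q₀ with () ← p⇒q₀ _

∨-monoʳ-T : ∀ a {b c} → (T b → T c) → T (a ∨ b) → T (a ∨ c)
∨-monoʳ-T true  _   _ = _
∨-monoʳ-T false b⇒c   = b⇒c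

∧-monoʳ-T : ∀ a {b c} → (T b → T c) → T (a ∧ b) → T (a ∧ c)
∧-monoʳ-T true b⇒c = b⇒c

<?-≤-trans : ∀ {n} {i j m : Fin n} → i Fin.≤ j → T ⌊ j Fin.<? m ⌋ → T ⌊ i Fin.<? m ⌋
<?-≤-trans i≤j j<m = fromWitness (ℕ.≤-<-trans i≤j (toWitness j<m))

module _ {n} (ℓ : ℕ) {x : Fin n → ℤ} {i j : Fin n} (i≤j : i Fin.≤ j) (xi≡xj : x i ≡ x j) where

  beats-tie : ∀ m → T (beats ℓ x m j) → T (beats ℓ x m i)
  beats-tie m
    with isMult ℓ (x m) | isMult ℓ (x i) | isMult ℓ (x j) | cong (isMult ℓ) xi≡xj
  ... | true  | false | false | _ = _
  ... | false | true  | true  | _ = λ ()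
  ... | true  | true  | true  | _ rewrite xi≡xj =
    ∨-monoʳ-T ⌊ x m ℤ.<? x j ⌋ (∧-monoʳ-T ⌊ x m ℤ.≟ x j ⌋ (<?-≤-trans i≤j))
  ... | false | false | false | _ rewrite xi≡xj =
    ∨-monoʳ-T ⌊ x j ℤ.<? x m ⌋ (∧-monoʳ-T ⌊ x m ℤ.≟ x j ⌋ (<?-≤-trans i≤j))

  rank-tie : rank ℓ x j ℕ.≤ rank ℓ x i
  rank-tie = count-mono beats-tie

isBear-tie : ∀ {n} k ℓ {x : Fin n → ℤ} {i j} → i Fin.≤ j → x i ≡ x j →
  T (isBear k ℓ x i) → T (isBear k ℓ x j)
isBear-tie k ℓ i≤j xi≡xj i-bear =
  fromWitness (ℕ.≤-<-trans (rank-tie ℓ i≤j xi≡xj) (toWitness i-bear))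

<⇒≤-1 : ∀ {a b : ℤ} → a ℤ.< b → a ℤ.≤ b - 1ℤ
<⇒≤-1 {a} {b} a<b = subst (a ℤ.≤_) (ℤ.+-comm -1ℤ b) (ℤ.i<j⇒i≤pred[j] a<b)

mainTheorem5 : (n k ℓ : ℕ) → 0 < k → k < n → 1 < ℓ → (x : Fin n → ℤ) →
    Monotone x → Monotone (gmMove k ℓ x)
mainTheorem5 n k ℓ _ _ _ x mono i j i≤j
  with isBear k ℓ x i | isBear k ℓ x j | isBear-tie k ℓ {x} i≤j
... | true  | true  | _      = mono i j i≤j
... | false | false | _      = ℤ.+-monoˡ-≤ -1ℤ (mono i j i≤j)
... | false | true  | _      = ℤ.≤-trans (ℤ.i-j≤i (x i) 1ℤ) (mono i j i≤j)
... | true  | false | no-tie =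
  <⇒≤-1 (ℤ.≤∧≢⇒< (mono i j i≤j) (λ xi≡xj → no-tie xi≡xj _))
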